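{- A pair $(I,J)\in\mathbb{Z}^2$ occurs as the invariants of a monic integral binary cubic form if and only if one of the following holds: (a) $I\equiv0\pmod3$ and $J\equiv0\pmod{27}$; (b) $I\equiv1\pmod9$ and $J\equiv\pm2\pmod{27}$; (c) $I\equiv4\pmod9$ and $J\equiv\pm16\pmod{27}$; (d) $I\equiv7\pmod9$ and $J\equiv\pm7\pmod{27}$.
   Context: A monic integral binary cubic form is $g(X,Y)=X^3+rX^2Y+sXY^2+tY^3$ with $r,s,t\in\mathbb{Z}$; its invariants are $I(g)=r^2-3s$ and $J(g)=-2r^3+9rs-27t$. -}

module Defs where

open import Data.Integer using (ℤ; +_; -_; _+_; _-_; _*_; _^_)
open import Data.Integer.Divisibility using (_∣_)
open import Data.Product using (_×_; ∃-syntax)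
open import Data.Sum using (_⊎_)
open import Relation.Binary.PropositionalEquality using (_≡_)

-- Invariants of the monic integral binary cubic form X^3 + r X^2 Y + s X Y^2 + t Y^3
invI : ℤ → ℤ → ℤ → ℤ
invI r s t = r ^ 2 - + 3 * s

invJ : ℤ → ℤ → ℤ → ℤ
invJ r s t = - (+ 2) * r ^ 3 + + 9 * r * s - + 27 * t

_≡_[mod_] : ℤ → ℤ → ℤ → Set
a ≡ b [mod n ] = n ∣ (a - b)

OccursAsInvariants : ℤ → ℤ → Set
OccursAsInvariants I J = ∃[ r ] ∃[ s ] ∃[ t ] (invI r s t ≡ I × invJ r s t ≡ J)

InvariantConditions : ℤ → ℤ → Set
InvariantConditions I J =
  (I ≡ + 0 [mod + 3 ] × J ≡ + 0 [mod + 27 ])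
  ⊎ (I ≡ + 1 [mod + 9 ] × (J ≡ + 2 [mod + 27 ] ⊎ J ≡ - (+ 2) [mod + 27 ]))
  ⊎ (I ≡ + 4 [mod + 9 ] × (J ≡ + 16 [mod + 27 ] ⊎ J ≡ - (+ 16) [mod + 27 ]))
  ⊎ (I ≡ + 7 [mod + 9 ] × (J ≡ + 7 [mod + 27 ] ⊎ J ≡ - (+ 7) [mod + 27 ]))

{-# OPTIONS --safe #-}
-- Since I = r² − 3s, the invariant J equals r³ − 3rI − 27t. So (I, J) occurs iff for some r
-- I ≡ r² (mod 3) and J ≡ r³ − 3rI (mod 27), with s and t recovered from the two quotients.
-- This condition depends on r only modulo 3. For r ≡ 0 it is (a). For r ≡ ±1 it says I ≡ 1 (mod 3),
-- and as 3rI mod 27 depends only on I mod 9, writing I ≡ c ∈ {1, 4, 7} (mod 9) it becomes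
-- J ≡ ±(1 − 3c) (mod 27), which is (b)–(d).
module Submission where

open import Defs
open import Data.Integer using (ℤ; +_; -_; _+_; _-_; _*_; ∣_∣)
open import Data.Integer.DivMod using (a≡a%ℕn+[a/ℕn]*n; n%ℕd<d; _%ℕ_; _/ℕ_)
open import Data.Integer.Divisibility.Signed using (divides; ∣ᵤ⇒∣; ∣⇒∣ᵤ)
open import Data.Integer.Tactic.RingSolver using (solve-∀)
import Data.Nat as ℕ
import Data.Nat.Divisibility as ℕ
open import Data.Product using (_×_; _,_; ∃-syntax)
open import Data.Sum using (_⊎_; inj₁; inj₂)
open import Function.Bundles using (_⇔_; mk⇔; Equivalence)
open Equivalence using (to; from)
open import Relation.Nullary.Decidable using (Dec; True; toWitness)
open import Relation.Binary.PropositionalEquality using (_≡_; refl; trans; cong)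

≡[mod]-intro : ∀ {a} b k n → a ≡ b + k * n → a ≡ b [mod n ]
≡[mod]-intro b k n a≡b+kn = ∣⇒∣ᵤ (divides k (trans (cong (λ x → x - b) a≡b+kn) (cancel b k n)))
  where
  cancel : ∀ b k n → b + k * n - b ≡ k * n
  cancel = solve-∀

≡[mod]-elim : ∀ a b n → a ≡ b [mod n ] → ∃[ k ] a ≡ b + k * n
≡[mod]-elim a b n a≡b with ∣ᵤ⇒∣ a≡b
... | divides k a-b≡k*n = k , trans (split a b) (cong (λ x → b + x) a-b≡k*n)
  where
  split : ∀ a b → a ≡ b + (a - b)
  split = solve-∀

_≡?_[mod_] : ∀ a b n → Dec (a ≡ b [mod n ])
a ≡? b [mod n ] = ∣ n ∣ ℕ.∣? ∣ a - b ∣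

≡[mod]-sym : ∀ a b n → a ≡ b [mod n ] → b ≡ a [mod n ]
≡[mod]-sym a b n a≡b with ≡[mod]-elim a b n a≡b
... | k , refl = ≡[mod]-intro (b + k * n) (- k) n (identity b k n)
  where
  identity : ∀ b k n → b ≡ b + k * n + - k * n
  identity = solve-∀

≡[mod]-trans : ∀ a b c n → a ≡ b [mod n ] → b ≡ c [mod n ] → a ≡ c [mod n ]
≡[mod]-trans a b c n a≡b b≡c with ≡[mod]-elim a b n a≡b | ≡[mod]-elim b c n b≡c
... | k , refl | l , refl = ≡[mod]-intro c (l + k) n (identity c k l n)
  where
  identity : ∀ c k l n → c + l * n + k * n ≡ c + (l + k) * n
  identity = solve-∀

≡[mod]-affine : ∀ a b n c m → a ≡ b [mod n ] → (c + a * m) ≡ c + b * m [mod n * m ]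
≡[mod]-affine a b n c m a≡b with ≡[mod]-elim a b n a≡b
... | k , refl = ≡[mod]-intro (c + b * m) k (n * m) (identity b c k m n)
  where
  identity : ∀ b c k m n → c + (b + k * n) * m ≡ c + b * m + k * (n * m)
  identity = solve-∀

≡[mod]-weaken : ∀ a b m n → a ≡ b [mod m * n ] → a ≡ b [mod n ]
≡[mod]-weaken a b m n a≡b with ≡[mod]-elim a b (m * n) a≡b
... | k , refl = ≡[mod]-intro b (k * m) n (identity b k m n)
  where
  identity : ∀ b k m n → b + k * (m * n) ≡ b + k * m * n
  identity = solve-∀

mod3-residue : ∀ a → a ≡ + 0 [mod + 3 ] ⊎ a ≡ + 1 [mod + 3 ] ⊎ a ≡ + 2 [mod + 3 ]
mod3-residue a with a %ℕ 3 | a≡a%ℕn+[a/ℕn]*n a 3 | n%ℕd<d a 3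
... | 0 | a≡ | _ = inj₁ (≡[mod]-intro (+ 0) (a /ℕ 3) (+ 3) a≡)
... | 1 | a≡ | _ = inj₂ (inj₁ (≡[mod]-intro (+ 1) (a /ℕ 3) (+ 3) a≡))
... | 2 | a≡ | _ = inj₂ (inj₂ (≡[mod]-intro (+ 2) (a /ℕ 3) (+ 3) a≡))
... | ℕ.suc (ℕ.suc (ℕ.suc _)) | _ | ℕ.s≤s (ℕ.s≤s (ℕ.s≤s ()))

≡1[mod3]⇒mod9 : ∀ a → a ≡ + 1 [mod + 3 ] →
                a ≡ + 1 [mod + 9 ] ⊎ a ≡ + 4 [mod + 9 ] ⊎ a ≡ + 7 [mod + 9 ]
≡1[mod3]⇒mod9 a a≡1 with ≡[mod]-elim a (+ 1) (+ 3) a≡1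
... | m , refl with mod3-residue m
...   | inj₁ m≡0 = inj₁ (≡[mod]-affine m (+ 0) (+ 3) (+ 1) (+ 3) m≡0)
...   | inj₂ (inj₁ m≡1) = inj₂ (inj₁ (≡[mod]-affine m (+ 1) (+ 3) (+ 1) (+ 3) m≡1))
...   | inj₂ (inj₂ m≡2) = inj₂ (inj₂ (≡[mod]-affine m (+ 2) (+ 3) (+ 1) (+ 3) m≡2))

≡[mod]-sub-scale : ∀ a b n x m k → a ≡ b [mod n ] →
                   (x - m * k * a) ≡ x - m * k * b [mod m * n ]
≡[mod]-sub-scale a b n x m k a≡b with ≡[mod]-elim a b n a≡b
... | j , refl = ≡[mod]-intro (x - m * k * b) (- (k * j)) (m * n) (identity b j k m n x)
  where
  identity : ∀ b j k m n x → x - m * k * (b + j * n) ≡ x - m * k * b + - (k * j) * (m * n)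
  identity = solve-∀

invI-as-residue : ∀ r s t → invI r s t ≡ r * r + (- s) * + 3
invI-as-residue r s t = identity r s
  where
  identity : ∀ r s → r * (r * + 1) - + 3 * s ≡ r * r + (- s) * + 3
  identity = solve-∀

invJ-as-residue : ∀ r s t → invJ r s t ≡ r * r * r - + 3 * r * invI r s t + (- t) * + 27
invJ-as-residue r s t = identity r s t
  where
  identity : ∀ r s t → - (+ 2) * (r * (r * (r * + 1))) + + 9 * r * s - + 27 * t
                       ≡ r * r * r - + 3 * r * (r * (r * + 1) - + 3 * s) + (- t) * + 27
  identity = solve-∀

Realisable : ℤ → ℤ → ℤ → Set
Realisable r I J = I ≡ r * r [mod + 3 ] × J ≡ r * r * r - + 3 * r * I [mod + 27 ]

occurs⇒realisable : ∀ I J → OccursAsInvariants I J → ∃[ r ] Realisable r I J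
occurs⇒realisable _ _ (r , s , t , refl , refl) =
  r , ≡[mod]-intro (r * r) (- s) (+ 3) (invI-as-residue r s t)
    , ≡[mod]-intro (r * r * r - + 3 * r * invI r s t) (- t) (+ 27) (invJ-as-residue r s t)

realisable⇒occurs : ∀ r I J → Realisable r I J → OccursAsInvariants I J
realisable⇒occurs r I J (I≡r² , J≡) with ≡[mod]-elim I (r * r) (+ 3) I≡r²
... | a , refl with ≡[mod]-elim J (r * r * r - + 3 * r * I) (+ 27) J≡
...   | b , refl = r , - a , - b , identityI r a , identityJ r a b
  where
  identityI : ∀ r a → r * (r * + 1) - + 3 * - a ≡ r * r + a * + 3
  identityI = solve-∀
  identityJ : ∀ r a b → - (+ 2) * (r * (r * (r * + 1))) + + 9 * r * - a - + 27 * - b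
                        ≡ r * r * r - + 3 * r * (r * r + a * + 3) + b * + 27
  identityJ = solve-∀

realisable-mod3 : ∀ r ρ I J → r ≡ ρ [mod + 3 ] → Realisable r I J → Realisable ρ I J
realisable-mod3 r ρ I J r≡ρ (I≡r² , J≡) with ≡[mod]-elim r ρ (+ 3) r≡ρ
... | k , refl with ≡[mod]-elim I (r * r) (+ 3) I≡r²
...   | a , refl with ≡[mod]-elim J (r * r * r - + 3 * r * I) (+ 27) J≡
...     | b , refl =
  ≡[mod]-intro (ρ * ρ) (a + + 2 * ρ * k + + 3 * k * k) (+ 3) (identityI ρ k a) ,
  ≡[mod]-intro (ρ * ρ * ρ - + 3 * ρ * I) (b - k * a - ρ * k * k - + 2 * k * k * k) (+ 27) (identityJ ρ k a b)
  where
  identityI : ∀ ρ k a → (ρ + k * + 3) * (ρ + k * + 3) + a * + 3 ≡ ρ * ρ + (a + + 2 * ρ * k + + 3 * k * k) * + 3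
  identityI = solve-∀
  identityJ : ∀ ρ k a b →
    (ρ + k * + 3) * (ρ + k * + 3) * (ρ + k * + 3) - + 3 * (ρ + k * + 3) * ((ρ + k * + 3) * (ρ + k * + 3) + a * + 3) + b * + 27
    ≡ ρ * ρ * ρ - + 3 * ρ * ((ρ + k * + 3) * (ρ + k * + 3) + a * + 3)
      + (b - k * a - ρ * k * k - + 2 * k * k * k) * + 27
  identityJ = solve-∀

-- The side conditions only involve literals at every use, where they are discharged by evaluation.
realisable⇔ : ∀ ρ c d I J → True (c ≡? ρ * ρ [mod + 3 ]) → True ((ρ * ρ * ρ - + 3 * ρ * c) ≡? d [mod + 27 ]) →
              I ≡ c [mod + 9 ] → Realisable ρ I J ⇔ J ≡ d [mod + 27 ]
realisable⇔ ρ c d I J c≡ρ²? ρ³-3ρc≡d? I≡c = mk⇔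
  (λ (_ , J≡ρ³-3ρI) → ≡[mod]-trans J ρ³-3ρc d (+ 27)
                        (≡[mod]-trans J ρ³-3ρI ρ³-3ρc (+ 27) J≡ρ³-3ρI shift) ρ³-3ρc≡d)
  (λ J≡d → ≡[mod]-trans I c (ρ * ρ) (+ 3) (≡[mod]-weaken I c (+ 3) (+ 3) I≡c) (toWitness c≡ρ²?)
         , ≡[mod]-trans J ρ³-3ρc ρ³-3ρI (+ 27)
             (≡[mod]-trans J d ρ³-3ρc (+ 27) J≡d (≡[mod]-sym ρ³-3ρc d (+ 27) ρ³-3ρc≡d))
             (≡[mod]-sym ρ³-3ρI ρ³-3ρc (+ 27) shift))
  where
  ρ³-3ρI ρ³-3ρc : ℤ
  ρ³-3ρI = ρ * ρ * ρ - + 3 * ρ * I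
  ρ³-3ρc = ρ * ρ * ρ - + 3 * ρ * c
  ρ³-3ρc≡d : ρ³-3ρc ≡ d [mod + 27 ]
  ρ³-3ρc≡d = toWitness ρ³-3ρc≡d?
  shift : ρ³-3ρI ≡ ρ³-3ρc [mod + 27 ]
  shift = ≡[mod]-sub-scale I c (+ 9) (ρ * ρ * ρ) (+ 3) ρ I≡c

realisable[+1]⇒conditions : ∀ I J → Realisable (+ 1) I J → InvariantConditions I J
realisable[+1]⇒conditions I J R@(I≡1 , _) with ≡1[mod3]⇒mod9 I I≡1
... | inj₁ I≡1[9] = inj₂ (inj₁ (I≡1[9] , inj₂ (to (realisable⇔ (+ 1) (+ 1) (- + 2) I J _ _ I≡1[9]) R)))
... | inj₂ (inj₁ I≡4) = inj₂ (inj₂ (inj₁ (I≡4 , inj₁ (to (realisable⇔ (+ 1) (+ 4) (+ 16) I J _ _ I≡4) R))))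
... | inj₂ (inj₂ I≡7) = inj₂ (inj₂ (inj₂ (I≡7 , inj₁ (to (realisable⇔ (+ 1) (+ 7) (+ 7) I J _ _ I≡7) R))))

realisable[-1]⇒conditions : ∀ I J → Realisable (- + 1) I J → InvariantConditions I J
realisable[-1]⇒conditions I J R@(I≡1 , _) with ≡1[mod3]⇒mod9 I I≡1
... | inj₁ I≡1[9] = inj₂ (inj₁ (I≡1[9] , inj₁ (to (realisable⇔ (- + 1) (+ 1) (+ 2) I J _ _ I≡1[9]) R)))
... | inj₂ (inj₁ I≡4) = inj₂ (inj₂ (inj₁ (I≡4 , inj₂ (to (realisable⇔ (- + 1) (+ 4) (- + 16) I J _ _ I≡4) R))))
... | inj₂ (inj₂ I≡7) = inj₂ (inj₂ (inj₂ (I≡7 , inj₂ (to (realisable⇔ (- + 1) (+ 7) (- + 7) I J _ _ I≡7) R))))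

realisable⇒conditions : ∀ r I J → Realisable r I J → InvariantConditions I J
realisable⇒conditions r I J R with mod3-residue r
... | inj₁ r≡0 = inj₁ (realisable-mod3 r (+ 0) I J r≡0 R)
... | inj₂ (inj₁ r≡1) = realisable[+1]⇒conditions I J (realisable-mod3 r (+ 1) I J r≡1 R)
... | inj₂ (inj₂ r≡2) = realisable[-1]⇒conditions I J (realisable-mod3 r (- + 1) I J r≡-1 R)
  where
  r≡-1 : r ≡ - + 1 [mod + 3 ]
  r≡-1 = ≡[mod]-trans r (+ 2) (- + 1) (+ 3) r≡2 (≡[mod]-intro (- + 1) (+ 1) (+ 3) refl)

-- Realisable (+ 0) I J computes to condition (a).
conditions⇒realisable : ∀ I J → InvariantConditions I J → ∃[ r ] Realisable r I J
conditions⇒realisable I J (inj₁ I≡0,J≡0) = + 0 , I≡0,J≡0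
conditions⇒realisable I J (inj₂ (inj₁ (I≡1 , inj₁ J≡2))) =
  - + 1 , from (realisable⇔ (- + 1) (+ 1) (+ 2) I J _ _ I≡1) J≡2
conditions⇒realisable I J (inj₂ (inj₁ (I≡1 , inj₂ J≡-2))) =
  + 1 , from (realisable⇔ (+ 1) (+ 1) (- + 2) I J _ _ I≡1) J≡-2
conditions⇒realisable I J (inj₂ (inj₂ (inj₁ (I≡4 , inj₁ J≡16)))) =
  + 1 , from (realisable⇔ (+ 1) (+ 4) (+ 16) I J _ _ I≡4) J≡16
conditions⇒realisable I J (inj₂ (inj₂ (inj₁ (I≡4 , inj₂ J≡-16)))) =
  - + 1 , from (realisable⇔ (- + 1) (+ 4) (- + 16) I J _ _ I≡4) J≡-16
conditions⇒realisable I J (inj₂ (inj₂ (inj₂ (I≡7 , inj₁ J≡7)))) =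
  + 1 , from (realisable⇔ (+ 1) (+ 7) (+ 7) I J _ _ I≡7) J≡7
conditions⇒realisable I J (inj₂ (inj₂ (inj₂ (I≡7 , inj₂ J≡-7)))) =
  - + 1 , from (realisable⇔ (- + 1) (+ 7) (- + 7) I J _ _ I≡7) J≡-7

proposition3p2 : (I J : ℤ) → (OccursAsInvariants I J → InvariantConditions I J) × (InvariantConditions I J → OccursAsInvariants I J)
proposition3p2 I J = occurs⇒conditions , conditions⇒occurs
  where
  occurs⇒conditions : OccursAsInvariants I J → InvariantConditions I J
  occurs⇒conditions occurs with occurs⇒realisable I J occurs
  ... | r , R = realisable⇒conditions r I J R
  conditions⇒occurs : InvariantConditions I J → OccursAsInvariants I J
  conditions⇒occurs conditions with conditions⇒realisable I J conditions
  ... | r , R = realisable⇒occurs r I J R
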